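{- If $T$ is a $\gamma_{tR}$-edge-critical tree, then $T$ contains no stem of degree at least $3$, and hence no strong stem.
   Context: All graphs are finite and simple. In a tree, a stem is a vertex adjacent to a leaf; a stem is strong if it is adjacent to two or more leaves. For a graph $G$ with no isolated vertices, a total Roman dominating function is a map $f:V(G)\to\{0,1,2\}$ such that every vertex with $f(v)=0$ is adjacent to a vertex $u$ with $f(u)=2$, and the subgraph induced by $\{v:f(v)>0\}$ has no isolated vertices; $\gamma_{tR}(G)$ is the minimum of $\sum_v f(v)$ over such $f$. $G$ is $\gamma_{tR}$-edge-critical if $E(\overline{G})\neq\emptyset$ and $\gamma_{tR}(G+e)<\gamma_{tR}(G)$ for every $e\in E(\overline{G})$. -}

module Defs where

open import Data.Nat using (ℕ; zero; suc; _+_; _≤_; _<_)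
open import Data.Fin using (Fin; _≟_)
open import Data.Bool using (Bool; true; false; _∨_; _∧_; if_then_else_)
open import Data.List using (List; []; _∷_; _++_; [_]; length; map; allFin)
open import Data.Nat.ListAction using (sum)
open import Data.List.Relation.Unary.Linked using (Linked)
open import Data.List.Relation.Unary.Unique.Propositional using (Unique)
open import Data.Product using (Σ; _×_; _,_; ∃)
open import Relation.Binary.PropositionalEquality using (_≡_; _≢_; refl; sym; trans; cong)
open import Relation.Nullary using (¬_; does)

record Graph (n : ℕ) : Set where
  field
    adj    : Fin n → Fin n → Bool
    adj-sym    : ∀ u v → adj u v ≡ adj v u
    adj-irrefl : ∀ v → adj v v ≡ false
open Graph public

Adj : ∀ {n} → Graph n → Fin n → Fin n → Set
Adj G u v = adj G u v ≡ true

deg : ∀ {n} → Graph n → Fin n → ℕ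
deg {n} G v = sum (map (λ u → if adj G v u then 1 else 0) (allFin n))

data Walk {n} (G : Graph n) : Fin n → Fin n → Set where
  here : ∀ {u} → Walk G u u
  step : ∀ {u w v} → Adj G u w → Walk G w v → Walk G u v

Connected : ∀ {n} → Graph n → Set
Connected {n} G = (u v : Fin n) → Walk G u v

HasCycle : ∀ {n} → Graph n → Set
HasCycle {n} G = Σ (Fin n) λ x → Σ (List (Fin n)) λ ys →
  (2 ≤ length ys) × Unique (x ∷ ys) × Linked (Adj G) (x ∷ ys ++ [ x ])

IsTree : ∀ {n} → Graph n → Set
IsTree G = Connected G × ¬ HasCycle G

IsLeaf : ∀ {n} → Graph n → Fin n → Set
IsLeaf G v = deg G v ≡ 1

IsStem : ∀ {n} → Graph n → Fin n → Set
IsStem G v = Σ _ λ l → Adj G v l × IsLeaf G l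

IsStrongStem : ∀ {n} → Graph n → Fin n → Set
IsStrongStem G v = Σ _ λ l₁ → Σ _ λ l₂ → l₁ ≢ l₂ ×
  Adj G v l₁ × IsLeaf G l₁ × Adj G v l₂ × IsLeaf G l₂

NoIsolated : ∀ {n} → Graph n → Set
NoIsolated {n} G = (v : Fin n) → Σ (Fin n) λ u → Adj G v u

private
  eqb : ∀ {n} → Fin n → Fin n → Bool
  eqb a b = does (a ≟ b)

  new : ∀ {n} → Fin n → Fin n → Fin n → Fin n → Bool
  new u v x y = (eqb x u ∧ eqb y v) ∨ (eqb x v ∧ eqb y u)

  ∨-comm : ∀ a b → (a ∨ b) ≡ (b ∨ a)
  ∨-comm false false = refl
  ∨-comm false true = refl
  ∨-comm true false = refl
  ∨-comm true true = refl

  ∧-comm : ∀ a b → (a ∧ b) ≡ (b ∧ a)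
  ∧-comm false false = refl
  ∧-comm false true = refl
  ∧-comm true false = refl
  ∧-comm true true = refl

  new-sym : ∀ {n} (u v x y : Fin n) → new u v x y ≡ new u v y x
  new-sym u v x y = trans (∨-comm (eqb x u ∧ eqb y v) _)
    (cong₂' (∧-comm (eqb x v) (eqb y u)) (∧-comm (eqb x u) (eqb y v)))
    where
    cong₂' : ∀ {a b c d} → a ≡ b → c ≡ d → (a ∨ c) ≡ (b ∨ d)
    cong₂' refl refl = refl

  new-irrefl : ∀ {n} (u v : Fin n) → u ≢ v → ∀ x → new u v x x ≡ false
  new-irrefl u v u≢v x with x ≟ u | x ≟ v
  ... | Relation.Nullary.yes refl | Relation.Nullary.yes refl = Data.Empty.⊥-elim (u≢v refl)
    where import Data.Empty
  ... | Relation.Nullary.yes _ | Relation.Nullary.no _ = refl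
  ... | Relation.Nullary.no _ | Relation.Nullary.yes _ = refl
  ... | Relation.Nullary.no _ | Relation.Nullary.no _ = refl

addEdge : ∀ {n} (G : Graph n) (u v : Fin n) → u ≢ v → Graph n
addEdge G u v u≢v = record
  { adj = λ x y → adj G x y ∨ new u v x y
  ; adj-sym = λ x y → c (adj-sym G x y) (new-sym u v x y)
  ; adj-irrefl = λ x → c (adj-irrefl G x) (new-irrefl u v u≢v x)
  }
  where
  c : ∀ {a b p q} → a ≡ b → p ≡ q → (a ∨ p) ≡ (b ∨ q)
  c refl refl = refl

record IsTRDF {n} (G : Graph n) (f : Fin n → ℕ) : Set where
  field
    bounded : ∀ v → f v ≤ 2
    zero-dominated : ∀ v → f v ≡ 0 → Σ (Fin n) λ u → Adj G v u × f u ≡ 2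
    positive-no-isolated : ∀ v → 0 < f v → Σ (Fin n) λ u → Adj G v u × 0 < f u

weight : ∀ {n} → (Fin n → ℕ) → ℕ
weight {n} f = sum (map f (allFin n))

IsγtR : ∀ {n} → Graph n → ℕ → Set
IsγtR {n} G k = (Σ (Fin n → ℕ) λ f → IsTRDF G f × weight f ≡ k)
              × (∀ f → IsTRDF G f → k ≤ weight f)

EdgeCritical : ∀ {n} → Graph n → Set
EdgeCritical {n} G =
  NoIsolated G
  × (Σ (Fin n) λ u → Σ (Fin n) λ v → u ≢ v × adj G u v ≡ false)
  × ((u v : Fin n) (u≢v : u ≢ v) → adj G u v ≡ false →
       Σ ℕ λ k → Σ ℕ λ k' → IsγtR G k × IsγtR (addEdge G u v u≢v) k' × k' < k)

-- Suppose the stem v of a leaf l has two further neighbours w and x. Since T has no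
-- triangle, wx is a non-edge, and every TRDF f of T + wx yields a TRDF of T that is no
-- heavier, so γtR does not drop and T is not edge-critical. If f v = 2 or f w = f x = 0
-- the edge wx is useless and f itself works. Otherwise l and v are both positive (l can
-- only lean on v), and putting 2 on v and 0 on l costs no more than f l + f v; v now
-- dominates w and x, which makes the edge wx superfluous. A strong stem without further
-- neighbours is the centre of a component P₃, which becomes a triangle in T + wx; a TRDF
-- spends at least 3 on a triangle, and 2, 1, 0 on v, w, x is a TRDF of the P₃.
module Submission where

open import Defs
open import Data.Nat using (ℕ; _<_)
open import Data.Fin using (Fin)
open import Data.Product using (_×_)
open import Relation.Nullary using (¬_)

open import Data.Bool using (true; false; if_then_else_)
import Data.Bool.Properties as Bool
open import Data.Empty using (⊥-elim)
open import Data.Fin using (_≟_; punchIn) renaming (zero to fzero; suc to fsuc)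
open import Data.Fin.Properties using (punchInᵢ≢i; any?)
open import Data.List using (tabulate; []; _∷_)
open import Data.List.Properties using (map-tabulate)
open import Data.List.Relation.Unary.All using ([]; _∷_)
open import Data.List.Relation.Unary.AllPairs using ([]; _∷_)
open import Data.List.Relation.Unary.Linked using ([-]; _∷_)
open import Data.List.Relation.Unary.Unique.Propositional using (Unique)
open import Data.Nat using (zero; suc; _+_; _≤_; z≤n; s≤s; z<s)
import Data.Nat.ListAction as List
open import Data.Nat.Properties renaming (_≟_ to _≟ℕ_)
open import Algebra.Properties.CommutativeMonoid.Sum +-0-commutativeMonoid
  using (sum; sum-remove; sum-cong-≗; ∑-distrib-+; sum-replicate-zero)
open import Data.Nat.Tactic.RingSolver using (solve-∀)
open import Data.Product using (Σ; _,_; proj₁; proj₂)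
open import Data.Sum using (_⊎_; inj₁; inj₂; [_,_]′; swap)
open import Data.Vec.Functional using (updateAt)
open import Data.Vec.Functional.Properties using (updateAt-updates; updateAt-minimal)
open import Function using (id; _∘_; const; case_of_)
open import Relation.Binary.PropositionalEquality
open import Relation.Nullary using (yes; no)
open import Relation.Nullary.Decidable using (_×-dec_; ¬?)

weight≡sum : ∀ {n} (f : Fin n → ℕ) → weight f ≡ sum f
weight≡sum f = trans (cong List.sum (map-tabulate id f)) (sum-tabulate f)
  where
  sum-tabulate : ∀ {n} (f : Fin n → ℕ) → List.sum (tabulate f) ≡ sum f
  sum-tabulate {zero} f = refl
  sum-tabulate {suc n} f = cong (f fzero +_) (sum-tabulate (f ∘ fsuc))

weight-mono : ∀ {n} {f g : Fin n → ℕ} → (∀ i → f i ≤ g i) → weight f ≤ weight g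
weight-mono {f = f} {g} f≤g =
  subst₂ _≤_ (sym (weight≡sum f)) (sym (weight≡sum g)) (sum-mono f≤g)
  where
  sum-mono : ∀ {n} {f g : Fin n → ℕ} → (∀ i → f i ≤ g i) → sum f ≤ sum g
  sum-mono {zero} _ = z≤n
  sum-mono {suc n} f≤g = +-mono-≤ (f≤g fzero) (sum-mono (f≤g ∘ fsuc))

weight-+ : ∀ {n} (f g : Fin n → ℕ) → weight (λ i → f i + g i) ≡ weight f + weight g
weight-+ f g = begin
  weight (λ i → f i + g i)  ≡⟨ weight≡sum (λ i → f i + g i) ⟩
  sum (λ i → f i + g i)     ≡⟨ ∑-distrib-+ f g ⟩
  sum f + sum g             ≡⟨ cong₂ _+_ (weight≡sum f) (weight≡sum g) ⟨
  weight f + weight g       ∎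
  where open ≡-Reasoning

weight-agree-off : ∀ {n} (f g : Fin n → ℕ) a → (∀ i → i ≢ a → g i ≡ f i) →
  weight g + f a ≡ weight f + g a
weight-agree-off {suc n} f g a g≡f = begin
  weight g + f a                   ≡⟨ cong (_+ f a) (trans (weight≡sum g) (sum-remove {i = a} g)) ⟩
  g a + sum (g ∘ punchIn a) + f a  ≡⟨ cong (λ s → g a + s + f a) (sum-cong-≗ g≡f-off-a) ⟩
  g a + sum (f ∘ punchIn a) + f a  ≡⟨ swap-ends (g a) _ (f a) ⟩
  f a + sum (f ∘ punchIn a) + g a  ≡⟨ cong (_+ g a) (trans (weight≡sum f) (sum-remove {i = a} f)) ⟨
  weight f + g a                   ∎
  where
  open ≡-Reasoning
  g≡f-off-a : ∀ j → g (punchIn a j) ≡ f (punchIn a j)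
  g≡f-off-a j = g≡f (punchIn a j) (punchInᵢ≢i a j)
  swap-ends : ∀ p q r → p + q + r ≡ r + q + p
  swap-ends = solve-∀

infixl 6 _[_]≔_

_[_]≔_ : ∀ {n} → (Fin n → ℕ) → Fin n → ℕ → Fin n → ℕ
f [ a ]≔ k = updateAt f a (const k)

module _ {n} {f : Fin n → ℕ} {a : Fin n} {k : ℕ} where

  []≔-same : (f [ a ]≔ k) a ≡ k
  []≔-same = updateAt-updates a f

  []≔-other : ∀ {y} → y ≢ a → (f [ a ]≔ k) y ≡ f y
  []≔-other y≢a = updateAt-minimal _ a f y≢a

  []≔-bounded : ∀ {m} → (∀ y → f y ≤ m) → k ≤ m → ∀ y → (f [ a ]≔ k) y ≤ m
  []≔-bounded f≤m k≤m y with y ≟ a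
  ... | yes refl = subst (_≤ _) (sym []≔-same) k≤m
  ... | no y≢a = subst (_≤ _) (sym ([]≔-other y≢a)) (f≤m y)

  []≔-increasing : f a ≤ k → ∀ y → f y ≤ (f [ a ]≔ k) y
  []≔-increasing fa≤k y with y ≟ a
  ... | yes refl = subst (f y ≤_) (sym []≔-same) fa≤k
  ... | no y≢a = ≤-reflexive (sym ([]≔-other y≢a))

  weight-[]≔ : weight (f [ a ]≔ k) + f a ≡ weight f + k
  weight-[]≔ =
    trans (weight-agree-off f (f [ a ]≔ k) a (λ _ → []≔-other)) (cong (weight f +_) []≔-same)

weight-[]≔₂ : ∀ {n} {f : Fin n → ℕ} {a b j k} → a ≢ b →
  weight (f [ a ]≔ j [ b ]≔ k) + (f a + f b) ≡ weight f + (j + k)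
weight-[]≔₂ {n} {f} {a} {b} {j} {k} a≢b = begin
  weight g + (f a + f b)    ≡⟨ reorder (weight g) (f a) (f b) ⟩
  weight g + f b + f a      ≡⟨ cong (λ s → weight g + s + f a) ([]≔-other (a≢b ∘ sym)) ⟨
  weight g + f₁ b + f a     ≡⟨ cong (_+ f a) (weight-[]≔ {f = f₁}) ⟩
  weight f₁ + k + f a       ≡⟨ reorder′ (weight f₁) k (f a) ⟩
  weight f₁ + f a + k       ≡⟨ cong (_+ k) (weight-[]≔ {f = f}) ⟩
  weight f + j + k          ≡⟨ +-assoc (weight f) j k ⟩
  weight f + (j + k)        ∎
  where
  open ≡-Reasoning
  f₁ g : Fin n → ℕ
  f₁ = f [ a ]≔ j
  g = f₁ [ b ]≔ k
  reorder : ∀ m p q → m + (p + q) ≡ m + q + p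
  reorder = solve-∀
  reorder′ : ∀ m p q → m + p + q ≡ m + q + p
  reorder′ = solve-∀

δ : ∀ {n} → Fin n → Fin n → ℕ
δ a = const 0 [ a ]≔ 1

δ-same : ∀ {n} (a : Fin n) → δ a a ≡ 1
δ-same a = []≔-same {f = const 0} {a = a}

δ-other : ∀ {n} {a u : Fin n} → u ≢ a → δ a u ≡ 0
δ-other = []≔-other {f = const 0} {k = 1}

weight-δ : ∀ {n} (a : Fin n) → weight (δ a) ≡ 1
weight-δ {n} a = begin
  weight (δ a)              ≡⟨ +-identityʳ _ ⟨
  weight (δ a) + 0          ≡⟨ weight-[]≔ {f = const 0} {a = a} ⟩
  weight {n} (const 0) + 1  ≡⟨ cong (_+ 1) (trans (weight≡sum {n} (const 0)) (sum-replicate-zero n)) ⟩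
  1                         ∎
  where open ≡-Reasoning

m+c≡n+d⇒d≤c⇒m≤n : ∀ {m n c d} → m + c ≡ n + d → d ≤ c → m ≤ n
m+c≡n+d⇒d≤c⇒m≤n {m} {n} {c} e d≤c =
  +-cancelʳ-≤ c m n (≤-trans (≤-reflexive e) (+-monoʳ-≤ n d≤c))

module _ {n} (G : Graph n) where

  Adj-sym : ∀ {a b} → Adj G a b → Adj G b a
  Adj-sym {a} {b} ab = trans (adj-sym G b a) ab

  Adj⇒≢ : ∀ {a b} → Adj G a b → a ≢ b
  Adj⇒≢ {a} ab refl with trans (sym ab) (adj-irrefl G a)
  ... | ()

  private
    nbr : Fin n → Fin n → ℕ
    nbr v u = if adj G v u then 1 else 0

  deg≤2 : ∀ {v} a b → (∀ u → Adj G v u → u ≡ a ⊎ u ≡ b) → deg G v ≤ 2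
  deg≤2 {v} a b N⊆ab = begin
    weight (nbr v)                  ≤⟨ weight-mono nbr≤δa+δb ⟩
    weight (λ u → δ a u + δ b u)    ≡⟨ weight-+ (δ a) (δ b) ⟩
    weight (δ a) + weight (δ b)     ≡⟨ cong₂ _+_ (weight-δ a) (weight-δ b) ⟩
    2                               ∎
    where
    open ≤-Reasoning
    nbr≤δa+δb : ∀ u → nbr v u ≤ δ a u + δ b u
    nbr≤δa+δb u with adj G v u in vu
    ... | false = z≤n
    ... | true with N⊆ab u vu
    ... | inj₁ refl = ≤-trans (≤-reflexive (sym (δ-same a))) (m≤m+n _ _)
    ... | inj₂ refl = ≤-trans (≤-reflexive (sym (δ-same b))) (m≤n+m _ _)

  deg≥2 : ∀ {v a b} → a ≢ b → Adj G v a → Adj G v b → 2 ≤ deg G v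
  deg≥2 {v} {a} {b} a≢b va vb = begin
    2                               ≡⟨ cong₂ _+_ (weight-δ a) (weight-δ b) ⟨
    weight (δ a) + weight (δ b)     ≡⟨ weight-+ (δ a) (δ b) ⟨
    weight (λ u → δ a u + δ b u)    ≤⟨ weight-mono δa+δb≤nbr ⟩
    weight (nbr v)                  ∎
    where
    open ≤-Reasoning
    δa+δb≤nbr : ∀ u → δ a u + δ b u ≤ nbr v u
    δa+δb≤nbr u with u ≟ a | u ≟ b
    ... | yes refl | yes refl = ⊥-elim (a≢b refl)
    ... | yes refl | no u≢b rewrite va | δ-same a | δ-other u≢b = ≤-refl
    ... | no u≢a | yes refl rewrite vb | δ-other u≢a | δ-same b = ≤-refl
    ... | no u≢a | no u≢b rewrite δ-other u≢a | δ-other u≢b = z≤n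

  leaf-neighbour-unique : ∀ {l a b} → IsLeaf G l → Adj G a l → Adj G b l → a ≡ b
  leaf-neighbour-unique {l} {a} {b} leaf al bl with a ≟ b
  ... | yes a≡b = a≡b
  ... | no a≢b with subst (2 ≤_) leaf (deg≥2 a≢b (Adj-sym al) (Adj-sym bl))
  ... | s≤s ()

  neighbour-outside? : ∀ v a b →
    (Σ (Fin n) λ u → Adj G v u × u ≢ a × u ≢ b) ⊎
    (∀ u → Adj G v u → u ≡ a ⊎ u ≡ b)
  neighbour-outside? v a b
    with any? (λ u → adj G v u Bool.≟ true ×-dec ¬? (u ≟ a) ×-dec ¬? (u ≟ b))
  ... | yes found = inj₁ found
  ... | no none = inj₂ inside
    where
    inside : ∀ u → Adj G v u → u ≡ a ⊎ u ≡ b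
    inside u vu with u ≟ a | u ≟ b
    ... | yes u≡a | _ = inj₁ u≡a
    ... | no _ | yes u≡b = inj₂ u≡b
    ... | no u≢a | no u≢b = ⊥-elim (none (u , vu , u≢a , u≢b))

  acyclic⇒triangle-free : ¬ HasCycle G → ∀ {v w x} → Adj G v w → Adj G v x → w ≢ x →
    adj G w x ≡ false
  acyclic⇒triangle-free acyclic {v} {w} {x} vw vx w≢x with adj G w x in wx
  ... | false = refl
  ... | true =
    ⊥-elim (acyclic (v , w ∷ x ∷ [] , s≤s (s≤s z≤n) , distinct , vw ∷ wx ∷ Adj-sym vx ∷ [-]))
    where
    distinct : Unique (v ∷ w ∷ x ∷ [])
    distinct = (Adj⇒≢ vw ∷ Adj⇒≢ vx ∷ []) ∷ (w≢x ∷ []) ∷ [] ∷ []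

  Adj-addEdge⁻ : ∀ {w x} (w≢x : w ≢ x) {a b} → Adj (addEdge G w x w≢x) a b →
    Adj G a b ⊎ (a ≡ w × b ≡ x) ⊎ (a ≡ x × b ≡ w)
  Adj-addEdge⁻ {w} {x} _ {a} {b} e with adj G a b | a ≟ w | b ≟ x | a ≟ x | b ≟ w
  Adj-addEdge⁻ _ _  | true  | _     | _     | _     | _     = inj₁ refl
  Adj-addEdge⁻ _ _  | false | yes p | yes q | _     | _     = inj₂ (inj₁ (p , q))
  Adj-addEdge⁻ _ _  | false | _     | _     | yes p | yes q = inj₂ (inj₂ (p , q))
  Adj-addEdge⁻ _ () | false | yes _ | no _  | yes _ | no _
  Adj-addEdge⁻ _ () | false | yes _ | no _  | no _  | _
  Adj-addEdge⁻ _ () | false | no _  | _     | yes _ | no _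
  Adj-addEdge⁻ _ () | false | no _  | _     | no _  | _

  IsTRDF-deleteEdge : ∀ {w x} (w≢x : w ≢ x) {f} → IsTRDF (addEdge G w x w≢x) f →
    f w ≡ 0 → f x ≡ 0 → IsTRDF G f
  IsTRDF-deleteEdge w≢x {f} tf fw≡0 fx≡0 = record
    { bounded = IsTRDF.bounded tf ; zero-dominated = dominated ; positive-no-isolated = supported }
    where
    dominated : ∀ y → f y ≡ 0 → Σ (Fin n) λ u → Adj G y u × f u ≡ 2
    dominated y fy≡0 with IsTRDF.zero-dominated tf y fy≡0
    ... | u , yu , fu≡2 with Adj-addEdge⁻ w≢x yu
    ... | inj₁ yu′ = u , yu′ , fu≡2
    ... | inj₂ (inj₁ (_ , refl)) = ⊥-elim (0≢1+n (trans (sym fx≡0) fu≡2))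
    ... | inj₂ (inj₂ (_ , refl)) = ⊥-elim (0≢1+n (trans (sym fw≡0) fu≡2))
    supported : ∀ y → 0 < f y → Σ (Fin n) λ u → Adj G y u × 0 < f u
    supported y fy>0 with IsTRDF.positive-no-isolated tf y fy>0
    ... | u , yu , fu>0 with Adj-addEdge⁻ w≢x yu
    ... | inj₁ yu′ = u , yu′ , fu>0
    ... | inj₂ (inj₁ (refl , _)) = ⊥-elim (<-irrefl (sym fw≡0) fy>0)
    ... | inj₂ (inj₂ (refl , _)) = ⊥-elim (<-irrefl (sym fx≡0) fy>0)

  -- Every neighbour of c is served by c itself, so only vertices far from c need f.
  IsTRDF-transfer : ∀ {H : Graph n} {f g : Fin n → ℕ} c → IsTRDF H f →
    (∀ y → g y ≤ 2) → g c ≡ 2 → (Σ (Fin n) λ u → Adj G c u × 0 < g u) →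
    (∀ y → y ≢ c → ¬ Adj G y c →
       g y ≡ f y × (∀ {u} → Adj H y u → Adj G y u × f u ≤ g u)) →
    IsTRDF G g
  IsTRDF-transfer {H} {f} {g} c tf g≤2 gc≡2 c-supported far = record
    { bounded = g≤2 ; zero-dominated = dominated ; positive-no-isolated = supported }
    where
    far′ : ∀ y → y ≢ c → adj G y c ≡ false →
      g y ≡ f y × (∀ {u} → Adj H y u → Adj G y u × f u ≤ g u)
    far′ y y≢c yc≡false = far y y≢c λ yc → case trans (sym yc) yc≡false of λ ()
    dominated : ∀ y → g y ≡ 0 → Σ (Fin n) λ u → Adj G y u × g u ≡ 2
    dominated y gy≡0 with y ≟ c | adj G y c in yc
    ... | yes refl | _ = ⊥-elim (0≢1+n (trans (sym gy≡0) gc≡2))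
    ... | no _ | true = c , yc , gc≡2
    ... | no y≢c | false with far′ y y≢c yc
    ... | gy≡fy , lift with IsTRDF.zero-dominated tf y (trans (sym gy≡fy) gy≡0)
    ... | u , yu , fu≡2 with lift yu
    ... | yu′ , fu≤gu = u , yu′ , ≤-antisym (g≤2 u) (subst (_≤ g u) fu≡2 fu≤gu)
    supported : ∀ y → 0 < g y → Σ (Fin n) λ u → Adj G y u × 0 < g u
    supported y gy>0 with y ≟ c | adj G y c in yc
    ... | yes refl | _ = c-supported
    ... | no _ | true = c , yc , subst (0 <_) (sym gc≡2) z<s
    ... | no y≢c | false with far′ y y≢c yc
    ... | gy≡fy , lift with IsTRDF.positive-no-isolated tf y (subst (0 <_) gy≡fy gy>0)
    ... | u , yu , fu>0 with lift yu
    ... | yu′ , fu≤gu = u , yu′ , <-≤-trans fu>0 fu≤gu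

  module _ {f : Fin n → ℕ} (tf : IsTRDF G f) where

    private
      _⊆⟨_,_⟩ : Fin n → Fin n → Fin n → Set
      a ⊆⟨ b , c ⟩ = ∀ {u} → Adj G a u → u ≡ b ⊎ u ≡ c

      heavy : ∀ {a b c} → a ⊆⟨ b , c ⟩ → f a ≡ 2 → 3 ≤ f a + f b + f c
      heavy {a} Na fa≡2 with IsTRDF.positive-no-isolated tf a (subst (0 <_) (sym fa≡2) z<s)
      ... | u , au , fu>0 rewrite fa≡2 with Na au
      ... | inj₁ refl = s≤s (s≤s (≤-trans fu>0 (m≤m+n _ _)))
      ... | inj₂ refl = s≤s (s≤s (≤-trans fu>0 (m≤n+m _ _)))

      light : ∀ {a b c} → a ⊆⟨ b , c ⟩ → f b ≢ 2 → f c ≢ 2 → 1 ≤ f a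
      light {a} Na fb≢2 fc≢2 = n≢0⇒n>0 λ fa≡0 →
        case IsTRDF.zero-dominated tf a fa≡0 of λ where
          (u , au , fu≡2) → [ (λ { refl → fb≢2 fu≡2 }) , (λ { refl → fc≢2 fu≡2 }) ]′ (Na au)

      rotate : ∀ p q r → p + q + r ≡ q + r + p
      rotate = solve-∀

    IsTRDF-triangle-weight : ∀ {a b c} → a ⊆⟨ b , c ⟩ → b ⊆⟨ a , c ⟩ → c ⊆⟨ a , b ⟩ →
      3 ≤ f a + f b + f c
    IsTRDF-triangle-weight {a} {b} {c} Na Nb Nc with f a ≟ℕ 2 | f b ≟ℕ 2 | f c ≟ℕ 2
    ... | yes fa≡2 | _ | _ = heavy Na fa≡2
    ... | no _ | yes fb≡2 | _ = subst (3 ≤_) (sym (rotate (f a) _ _)) (heavy (swap ∘ Nb) fb≡2)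
    ... | no _ | no _ | yes fc≡2 = subst (3 ≤_) (rotate (f c) _ _) (heavy Nc fc≡2)
    ... | no fa≢2 | no fb≢2 | no fc≢2 =
      +-mono-≤ (+-mono-≤ (light Na fb≢2 fc≢2) (light Nb fa≢2 fc≢2)) (light Nc fa≢2 fb≢2)

-- γtR(G) ≤ γtR(G + wx), witnessed one function at a time.
NotLowering : ∀ {n} (G : Graph n) {w x : Fin n} → w ≢ x → Set
NotLowering {n} G {w} {x} w≢x = ∀ f → IsTRDF (addEdge G w x w≢x) f →
  Σ (Fin n → ℕ) λ g → IsTRDF G g × weight g ≤ weight f

EdgeCritical⇒lowering : ∀ {n} {G : Graph n} → EdgeCritical G →
  ∀ {w x} (w≢x : w ≢ x) → adj G w x ≡ false → ¬ NotLowering G w≢x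
EdgeCritical⇒lowering (_ , _ , critical) w≢x wx∉G lift with critical _ _ w≢x wx∉G
... | k , k′ , (_ , k≤) , ((f , tf , wf≡k′) , _) , k′<k with lift f tf
... | g , tg , wg≤wf = <⇒≱ k′<k (≤-trans (k≤ g tg) (subst (weight g ≤_) wf≡k′ wg≤wf))

module _ {n} {T : Graph n} {v w x : Fin n} (vw : Adj T v w) (vx : Adj T v x) (w≢x : w ≢ x) where

  private
    T′ : Graph n
    T′ = addEdge T w x w≢x

    v≢w : v ≢ w
    v≢w = Adj⇒≢ T vw

    v≢x : v ≢ x
    v≢x = Adj⇒≢ T vx

    unseen-from-far : ∀ {a y} → Adj T v a → ¬ Adj T y v → y ≢ a
    unseen-from-far va y≁v refl = y≁v (Adj-sym T va)

    leaf-unseen : ∀ {l y} → IsLeaf T l → Adj T v l → y ≢ v → ¬ Adj T y l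
    leaf-unseen leaf vl y≢v yl = y≢v (leaf-neighbour-unique T leaf yl vl)

  IsTRDF-centred : ∀ {f g} → IsTRDF T′ f → (∀ y → g y ≤ 2) → g v ≡ 2 →
    (Σ (Fin n) λ u → Adj T v u × 0 < g u) →
    (∀ y → y ≢ v → ¬ Adj T y v → g y ≡ f y × (∀ {u} → Adj T y u → f u ≤ g u)) →
    IsTRDF T g
  IsTRDF-centred {f} {g} tf g≤2 gv≡2 v-supported far =
    IsTRDF-transfer T v tf g≤2 gv≡2 v-supported far′
    where
    far′ : ∀ y → y ≢ v → ¬ Adj T y v →
      g y ≡ f y × (∀ {u} → Adj T′ y u → Adj T y u × f u ≤ g u)
    far′ y y≢v y≁v with far y y≢v y≁v
    ... | gy≡fy , lift = gy≡fy , λ yu → case Adj-addEdge⁻ T w≢x yu of λ where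
      (inj₁ yu′) → yu′ , lift yu′
      (inj₂ (inj₁ (refl , _))) → ⊥-elim (y≁v (Adj-sym T vw))
      (inj₂ (inj₂ (refl , _))) → ⊥-elim (y≁v (Adj-sym T vx))

  IsTRDF-centre≡2 : ∀ {f} → IsTRDF T′ f → f v ≡ 2 → IsTRDF T f
  IsTRDF-centre≡2 {f} tf fv≡2 =
    IsTRDF-centred tf (IsTRDF.bounded tf) fv≡2 v-supported (λ _ _ _ → refl , λ _ → ≤-refl)
    where
    v-supported : Σ (Fin n) λ u → Adj T v u × 0 < f u
    v-supported = case IsTRDF.positive-no-isolated tf v (subst (0 <_) (sym fv≡2) z<s) of λ where
      (u , vu , fu>0) → case Adj-addEdge⁻ T w≢x vu of λ where
        (inj₁ vu′) → u , vu′ , fu>0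
        (inj₂ (inj₁ (v≡w , _))) → ⊥-elim (v≢w v≡w)
        (inj₂ (inj₂ (v≡x , _))) → ⊥-elim (v≢x v≡x)

  module _ {l} (vl : Adj T v l) (leaf : IsLeaf T l) (l≢w : l ≢ w) (l≢x : l ≢ x) where

    private
      v≢l : v ≢ l
      v≢l = Adj⇒≢ T vl

      l-only-v : ∀ {u} → Adj T′ l u → u ≡ v
      l-only-v lu = case Adj-addEdge⁻ T w≢x lu of λ where
        (inj₁ lu′) → leaf-neighbour-unique T leaf (Adj-sym T lu′) vl
        (inj₂ (inj₁ (l≡w , _))) → ⊥-elim (l≢w l≡w)
        (inj₂ (inj₂ (l≡x , _))) → ⊥-elim (l≢x l≡x)

      centre-and-leaf-positive : ∀ {f} → IsTRDF T′ f → f v ≢ 2 → 0 < f v × 0 < f l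
      centre-and-leaf-positive {f} tf fv≢2 = fv>0 , fl>0
        where
        fl>0 : 0 < f l
        fl>0 = n≢0⇒n>0 λ fl≡0 → case IsTRDF.zero-dominated tf l fl≡0 of λ where
          (u , lu , fu≡2) → fv≢2 (subst (λ z → f z ≡ 2) (l-only-v lu) fu≡2)
        fv>0 : 0 < f v
        fv>0 = case IsTRDF.positive-no-isolated tf l fl>0 of λ where
          (u , lu , fu>0) → subst (λ z → 0 < f z) (l-only-v lu) fu>0

      shift-to-centre : ∀ {f} → IsTRDF T′ f → f v ≢ 2 →
        ∀ {p} → Adj T v p → p ≢ l → f p ≢ 0 →
        Σ (Fin n → ℕ) λ g → IsTRDF T g × weight g ≤ weight f
      shift-to-centre {f} tf fv≢2 {p} vp p≢l fp≢0 =
        g , tg , m+c≡n+d⇒d≤c⇒m≤n (weight-[]≔₂ v≢l) (+-mono-≤ fv>0 fl>0)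
        where
        fv>0 : 0 < f v
        fv>0 = proj₁ (centre-and-leaf-positive tf fv≢2)
        fl>0 : 0 < f l
        fl>0 = proj₂ (centre-and-leaf-positive tf fv≢2)
        g : Fin n → ℕ
        g = f [ v ]≔ 2 [ l ]≔ 0
        far : ∀ y → y ≢ v → ¬ Adj T y v → g y ≡ f y × (∀ {u} → Adj T y u → f u ≤ g u)
        far y y≢v y≁v = trans ([]≔-other (unseen-from-far vl y≁v)) ([]≔-other y≢v) , lift
          where
          lift : ∀ {u} → Adj T y u → f u ≤ g u
          lift {u} yu =
            subst (f u ≤_) (sym ([]≔-other u≢l)) ([]≔-increasing (IsTRDF.bounded tf v) u)
            where
            u≢l : u ≢ l
            u≢l refl = leaf-unseen leaf vl y≢v yu
        tg : IsTRDF T g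
        tg = IsTRDF-centred tf
          ([]≔-bounded ([]≔-bounded (IsTRDF.bounded tf) ≤-refl) z≤n)
          (trans ([]≔-other v≢l) ([]≔-same {f = f}))
          (p , vp , subst (0 <_) (sym (trans ([]≔-other p≢l) ([]≔-other (Adj⇒≢ T vp ∘ sym))))
                                 (n≢0⇒n>0 fp≢0))
          far

    NotLowering-otherLeaf : NotLowering T w≢x
    NotLowering-otherLeaf f tf with f v ≟ℕ 2 | f w ≟ℕ 0 | f x ≟ℕ 0
    ... | yes fv≡2 | _ | _ = f , IsTRDF-centre≡2 tf fv≡2 , ≤-refl
    ... | no _ | yes fw≡0 | yes fx≡0 = f , IsTRDF-deleteEdge T w≢x tf fw≡0 fx≡0 , ≤-refl
    ... | no fv≢2 | no fw≢0 | _ = shift-to-centre tf fv≢2 vw (l≢w ∘ sym) fw≢0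
    ... | no fv≢2 | yes _ | no fx≢0 = shift-to-centre tf fv≢2 vx (l≢x ∘ sym) fx≢0

  module _ (leaf-w : IsLeaf T w) (leaf-x : IsLeaf T x) (Nv : ∀ u → Adj T v u → u ≡ w ⊎ u ≡ x) where

    private
      triangle-weight : ∀ {f} → IsTRDF T′ f → 3 ≤ f v + f w + f x
      triangle-weight tf = IsTRDF-triangle-weight T′ tf Nv′ Nw′ Nx′
        where
        Nv′ : ∀ {u} → Adj T′ v u → u ≡ w ⊎ u ≡ x
        Nv′ vu = case Adj-addEdge⁻ T w≢x vu of λ where
          (inj₁ vu′) → Nv _ vu′
          (inj₂ (inj₁ (v≡w , _))) → ⊥-elim (v≢w v≡w)
          (inj₂ (inj₂ (v≡x , _))) → ⊥-elim (v≢x v≡x)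
        Nw′ : ∀ {u} → Adj T′ w u → u ≡ v ⊎ u ≡ x
        Nw′ wu = case Adj-addEdge⁻ T w≢x wu of λ where
          (inj₁ wu′) → inj₁ (leaf-neighbour-unique T leaf-w (Adj-sym T wu′) vw)
          (inj₂ (inj₁ (_ , u≡x))) → inj₂ u≡x
          (inj₂ (inj₂ (w≡x , _))) → ⊥-elim (w≢x w≡x)
        Nx′ : ∀ {u} → Adj T′ x u → u ≡ v ⊎ u ≡ w
        Nx′ xu = case Adj-addEdge⁻ T w≢x xu of λ where
          (inj₁ xu′) → inj₁ (leaf-neighbour-unique T leaf-x (Adj-sym T xu′) vx)
          (inj₂ (inj₁ (x≡w , _))) → ⊥-elim (w≢x (sym x≡w))
          (inj₂ (inj₂ (_ , u≡w))) → inj₂ u≡w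

    NotLowering-twoLeaves : NotLowering T w≢x
    NotLowering-twoLeaves f tf = g , tg , m+c≡n+d⇒d≤c⇒m≤n weight-g (triangle-weight tf)
      where
      f₂ g : Fin n → ℕ
      f₂ = f [ v ]≔ 2 [ w ]≔ 1
      g = f₂ [ x ]≔ 0
      weight-g : weight g + (f v + f w + f x) ≡ weight f + 3
      weight-g = begin
        weight g + (f v + f w + f x)      ≡⟨ reorder (weight g) (f v + f w) (f x) ⟩
        weight g + f x + (f v + f w)      ≡⟨ cong (λ s → weight g + s + (f v + f w)) f₂x≡fx ⟨
        weight g + f₂ x + (f v + f w)     ≡⟨ cong (_+ (f v + f w)) (weight-[]≔ {f = f₂}) ⟩
        weight f₂ + 0 + (f v + f w)       ≡⟨ cong (_+ (f v + f w)) (+-identityʳ (weight f₂)) ⟩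
        weight f₂ + (f v + f w)           ≡⟨ weight-[]≔₂ v≢w ⟩
        weight f + 3                      ∎
        where
        open ≡-Reasoning
        reorder : ∀ m p q → m + (p + q) ≡ m + q + p
        reorder = solve-∀
        f₂x≡fx : f₂ x ≡ f x
        f₂x≡fx = trans ([]≔-other (w≢x ∘ sym)) ([]≔-other (v≢x ∘ sym))
      tg : IsTRDF T g
      tg = IsTRDF-centred tf
        ([]≔-bounded ([]≔-bounded ([]≔-bounded (IsTRDF.bounded tf) ≤-refl) (s≤s z≤n)) z≤n)
        (trans ([]≔-other v≢x) (trans ([]≔-other v≢w) ([]≔-same {f = f})))
        (w , vw , subst (0 <_) (sym (trans ([]≔-other w≢x) ([]≔-same {f = f [ v ]≔ 2}))) z<s)
        far
        where
        far : ∀ y → y ≢ v → ¬ Adj T y v → g y ≡ f y × (∀ {u} → Adj T y u → f u ≤ g u)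
        far y y≢v y≁v =
          trans ([]≔-other (unseen-from-far vx y≁v))
                (trans ([]≔-other (unseen-from-far vw y≁v)) ([]≔-other y≢v)) ,
          lift
          where
          lift : ∀ {u} → Adj T y u → f u ≤ g u
          lift {u} yu = subst (f u ≤_) (sym (trans ([]≔-other u≢x) ([]≔-other u≢w)))
                          ([]≔-increasing (IsTRDF.bounded tf v) u)
            where
            u≢w : u ≢ w
            u≢w refl = leaf-unseen leaf-w vw y≢v yu
            u≢x : u ≢ x
            u≢x refl = leaf-unseen leaf-x vx y≢v yu

mainTheorem13 : {n : ℕ} (T : Graph n) → IsTree T → EdgeCritical T →
    ((v : Fin n) → IsStem T v → deg T v < 3) × ((v : Fin n) → ¬ IsStrongStem T v)
mainTheorem13 {n} T (_ , acyclic) critical = stem-deg<3 , no-strong-stem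
  where
  refute : ∀ {v w x} → Adj T v w → Adj T v x → (w≢x : w ≢ x) → ¬ NotLowering T w≢x
  refute vw vx w≢x =
    EdgeCritical⇒lowering critical w≢x (acyclic⇒triangle-free T acyclic vw vx w≢x)

  stem-deg<3 : (v : Fin n) → IsStem T v → deg T v < 3
  stem-deg<3 v (l , vl , leaf) with neighbour-outside? T v l l
  ... | inj₂ N⊆l = s≤s (deg≤2 T l l N⊆l)
  ... | inj₁ (w , vw , w≢l , _) with neighbour-outside? T v l w
  ... | inj₂ N⊆lw = s≤s (deg≤2 T l w N⊆lw)
  ... | inj₁ (x , vx , x≢l , x≢w) = ⊥-elim (refute vw vx w≢x
          (NotLowering-otherLeaf vw vx w≢x vl leaf (w≢l ∘ sym) (x≢l ∘ sym)))
    where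
    w≢x : w ≢ x
    w≢x = x≢w ∘ sym

  no-strong-stem : (v : Fin n) → ¬ IsStrongStem T v
  no-strong-stem v (l₁ , l₂ , l₁≢l₂ , vl₁ , leaf₁ , vl₂ , leaf₂)
    with neighbour-outside? T v l₁ l₂
  ... | inj₁ (x , vx , x≢l₁ , x≢l₂) = refute vl₂ vx l₂≢x
          (NotLowering-otherLeaf vl₂ vx l₂≢x vl₁ leaf₁ l₁≢l₂ (x≢l₁ ∘ sym))
    where
    l₂≢x : l₂ ≢ x
    l₂≢x = x≢l₂ ∘ sym
  ... | inj₂ N⊆l₁l₂ = refute vl₁ vl₂ l₁≢l₂
          (NotLowering-twoLeaves vl₁ vl₂ l₁≢l₂ leaf₁ leaf₂ N⊆l₁l₂)
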